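{- Let $(r_n)_{n \ge 0}$ be a ray of tree nim positions. Then the sequence $(\mathcal{G}(r_n))_{n\ge 0}$ of Grundy values contains every non-negative integer exactly once, and it is additively periodic: there exist integers $N \ge 0$, $\pi \ge 1$ and $s$ such that $\mathcal{G}(r_{n+\pi}) = \mathcal{G}(r_n) + s$ for all $n \ge N$.
   Context: A tree nim position is a finite tree, possibly empty, each of whose vertices carries a positive integer size. A leaf is a vertex of degree at most $1$. A move consists of choosing a leaf and decreasing its size by a positive integer; if its size becomes $0$, that vertex is deleted. Normal play. The Grundy value is defined recursively by $\mathcal{G}(p) = \operatorname{mex}\{\mathcal{G}(q) : q \text{ reachable from } p \text{ in one move}\}$, where $\operatorname{mex}$ of a set of non-negative integers is the least non-negative integer not in it. Ray: given a nonempty position $r_0$ and a vertex $v$ of $r_0$, for each $n \ge 1$ let $r_n$ be obtained from $r_0$ by adjoining a new vertex of size $n$ adjacent to $v$; the family $(r_n)_{n\ge0}$ is a ray. -}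

module Defs where

open import Data.Nat using (ℕ; zero; suc; _+_; _≟_)
open import Data.List using (List; []; _∷_; _++_; [_]; map; length; downFrom)
open import Data.List.Relation.Unary.Any using (Any; here; there; any?)
open import Data.Maybe using (Maybe; just; nothing)
open import Relation.Nullary using (yes; no)

-- A nonempty finite (unrooted) tree is represented by choosing a root:
-- `node k ts` is a vertex of size `suc k` (sizes are positive integers)
-- whose neighbours away from the root are the roots of the subtrees `ts`.
-- A position (possibly empty) is a `Maybe Tree`.

data Tree : Set where
  node : ℕ → List Tree → Tree

Position : Set
Position = Maybe Tree

-- A leaf is a vertex of degree ≤ 1 in the underlying unrooted
-- tree: the root if it has ≤ 1 children, a non-root vertex iff it has no
-- children.  A move decreases the size `suc k` of a leaf to `suc m` with
-- m < k (i.e. to any size 1..k), or to 0, deleting the vertex.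

mutual
  -- results of moves made inside a non-root subtree
  -- (`nothing` = the subtree's root was a leaf and got deleted)
  childMoves : Tree → List (Maybe Tree)
  childMoves (node k ts) =
    leafPart k ts ++ map (λ ts′ → just (node k ts′)) (forestMoves ts)

  forestMoves : List Tree → List (List Tree)
  forestMoves [] = []
  forestMoves (t ∷ ts) =
    map (λ { nothing → ts ; (just t′) → t′ ∷ ts }) (childMoves t)
    ++ map (t ∷_) (forestMoves ts)

  leafPart : ℕ → List Tree → List (Maybe Tree)
  leafPart k [] = nothing ∷ map (λ m → just (node m [])) (downFrom k)
  leafPart k (_ ∷ _) = []

rootPart : ℕ → List Tree → List Position
rootPart k [] = nothing ∷ map (λ m → just (node m [])) (downFrom k)
rootPart k (c ∷ []) = just c ∷ map (λ m → just (node m (c ∷ []))) (downFrom k)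
rootPart k (_ ∷ _ ∷ _) = []

options : Tree → List Position
options (node k ts) =
  rootPart k ts ++ map (λ ts′ → just (node k ts′)) (forestMoves ts)

-- mex of a finite set (list) of naturals: least n not in the list.
-- `mexFrom f n xs` searches n, n+1, ... ; fuel `length xs` is enough
-- since at most `length xs` consecutive values can be members.

mexFrom : ℕ → ℕ → List ℕ → ℕ
mexFrom zero n xs = n
mexFrom (suc f) n xs with any? (n ≟_) xs
... | yes _ = mexFrom f (suc n) xs
... | no _ = n

mex : List ℕ → ℕ
mex xs = mexFrom (length xs) 0 xs

-- Total size; every move decreases it by at least 1.

mutual
  weight : Tree → ℕ
  weight (node k ts) = suc k + weightF ts

  weightF : List Tree → ℕ
  weightF [] = 0
  weightF (t ∷ ts) = weight t + weightF ts

size : Position → ℕ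
size nothing = 0
size (just t) = weight t

-- Grundy value, by recursion with fuel; fuel ≥ size p is always
-- sufficient (options have strictly smaller size), so `grundy` below is
-- the genuine recursively defined Grundy value G(p) = mex {G(q)}.
grundyF : ℕ → Position → ℕ
grundyF _ nothing = 0
grundyF zero (just t) = 0
grundyF (suc f) (just t) = mex (map (grundyF f) (options t))

grundy : Position → ℕ
grundy p = grundyF (size p) p

data Vertex : Tree → Set where
  root  : ∀ {k ts} → Vertex (node k ts)
  below : ∀ {k ts} → Any Vertex ts → Vertex (node k ts)

mutual
  attach : (t : Tree) → Vertex t → Tree → Tree
  attach (node k ts) root u = node k (ts ++ [ u ])
  attach (node k ts) (below p) u = node k (attachAny ts p u)

  attachAny : (ts : List Tree) → Any Vertex ts → Tree → List Tree
  attachAny (t ∷ ts) (here p) u = attach t p u ∷ ts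
  attachAny (t ∷ ts) (there p) u = t ∷ attachAny ts p u

-- The ray (r_n): r_0 = r0, and r_n (n ≥ 1) is r0 with a new vertex of
-- size n (= suc m) adjacent to v.
ray : (r0 : Tree) → Vertex r0 → ℕ → Position
ray r0 v zero = just r0
ray r0 v (suc m) = just (attach r0 v (node m []))

{-# OPTIONS --safe #-}
-- For n ≥ 1 the options of r_n are r_0, …, r_(n-1) (moves on the new leaf) and the
-- positions C[n] for a list of K contexts C independent of n: the new leaf alone, or
-- a ray of smaller total size. By induction on the size each b_C(n) = G(C[n]) is
-- injective with b_C(n + p) = b_C(n) + p for large n, and a(n) = G(r_n) is the mex
-- of {a(j) : j < n} ∪ {b_C(n)}. Such an a is injective, and counting gives
-- a(n) ≤ n + K and shows that every x is taken before time x + K + 2. So once the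
-- b_C are periodic, the future of a after time t + K + 2 is determined by their phase
-- and by which of the boundedly many values t, t + 1, … have been taken: a finite
-- window. Pigeonhole gives equal windows at times t and t + π with π a common period
-- of the b_C, and the mex recurrence propagates a(n + π) = a(n) + π from there.

module Submission where

open import Defs
open import Data.Bool using (Bool; true; false)
open import Data.Empty using (⊥-elim)
open import Data.Fin as Fin using (Fin; toℕ; fromℕ<)
open import Data.Fin.Properties
  using (toℕ-fromℕ<; toℕ<n; toℕ-injective; injective⇒≤; pigeonhole; combine-injective)
open import Data.Integer using (ℤ; +_) renaming (_+_ to _+ℤ_)
open import Data.List using (List; []; _∷_; _++_; [_]; map; length; downFrom; lookup)
open import Data.List.Membership.Propositional using (_∈_)
open import Data.List.Membership.Propositional.Properties
  using (∈-map⁺; ∈-map⁻; ∈-++⁺ˡ; ∈-++⁺ʳ; ∈-++⁻; ∈-downFrom⁺; ∈-downFrom⁻; ∈-lookup)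
open import Data.List.Properties using (map-cong; map-cong-local)
open import Data.List.Relation.Unary.All as All using ()
open import Data.List.Relation.Unary.Any as Any using (Any; here; there)
open import Data.List.Relation.Unary.Any.Properties using (lookup-index)
open import Data.Maybe using (Maybe; just; nothing)
open import Data.Nat
open import Data.Nat.Induction using (<-rec; <-wellFounded)
open import Data.Nat.Properties
open import Algebra.Properties.CommutativeSemigroup +-commutativeSemigroup
  using (x∙yz≈xz∙y; xy∙z≈xz∙y)
open import Data.Product using (Σ; _×_; _,_; proj₁; proj₂; ∃-syntax)
open import Data.Sum using (_⊎_; inj₁; inj₂)
open import Data.Sum.Function.Propositional using (_⊎-⇔_)
open import Data.Vec as Vec using (Vec; []; _∷_; tabulate)
open import Data.Vec.Properties using (lookup∘tabulate)
open import Function using (_∘_; _⇔_; mk⇔; Equivalence)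
open import Function.Definitions using (Injective)
open import Function.Properties.Equivalence using () renaming (sym to ⇔-sym; trans to ⇔-trans)
open import Induction.WellFounded as WF using ()
open import Level using (0ℓ)
open import Relation.Binary using (tri<; tri≈; tri>)
open import Relation.Binary.Construct.On as On using ()
open import Relation.Binary.PropositionalEquality
  using (_≡_; refl; sym; trans; cong; cong₂; subst; subst₂; module ≡-Reasoning)
open import Relation.Nullary using (¬_; Dec; yes; no; does)

injective-below⇒≤ : ∀ {n m} (f : ∀ j → j < n → ℕ) → (∀ j p → f j p < m) →
  (∀ i j p q → f i p ≡ f j q → i ≡ j) → n ≤ m
injective-below⇒≤ f f<m f-inj = injective⇒≤ {f = g} g-injective
  where
  g : Fin _ → Fin _
  g i = fromℕ< (f<m (toℕ i) (toℕ<n i))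
  g-injective : Injective _≡_ _≡_ g
  g-injective {i} {j} gi≡gj = toℕ-injective (f-inj (toℕ i) (toℕ j) _ _ (begin
    f (toℕ i) _    ≡⟨ toℕ-fromℕ< _ ⟨
    toℕ (g i)      ≡⟨ cong toℕ gi≡gj ⟩
    toℕ (g j)      ≡⟨ toℕ-fromℕ< _ ⟩
    f (toℕ j) _    ∎))
    where open ≡-Reasoning

covers⇒≤length : ∀ {m} (xs : List ℕ) → (∀ {h} → h < m → h ∈ xs) → m ≤ length xs
covers⇒≤length xs covers = injective-below⇒≤ (λ _ p → toℕ (Any.index (covers p)))
  (λ _ _ → toℕ<n _)
  (λ _ _ p q e → trans (lookup-index (covers p))
                   (trans (cong (lookup xs) (toℕ-injective e)) (sym (lookup-index (covers q)))))

bitToFin : Bool → Fin 2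
bitToFin false = Fin.zero
bitToFin true = Fin.suc Fin.zero

bitToFin-injective : Injective _≡_ _≡_ bitToFin
bitToFin-injective {false} {false} _ = refl
bitToFin-injective {true} {true} _ = refl

vecToFin : ∀ {n} → Vec Bool n → Fin (2 ^ n)
vecToFin [] = Fin.zero
vecToFin (b ∷ bs) = Fin.combine (bitToFin b) (vecToFin bs)

vecToFin-injective : ∀ {n} → Injective _≡_ _≡_ (vecToFin {n})
vecToFin-injective {x = []} {[]} _ = refl
vecToFin-injective {x = b ∷ bs} {b′ ∷ bs′} e with combine-injective _ _ _ _ e
... | b≡b′ , bs≡bs′ = cong₂ _∷_ (bitToFin-injective b≡b′) (vecToFin-injective bs≡bs′)

vec-pigeonhole : ∀ {n} (f : ℕ → Vec Bool n) → ∃[ k ] ∃[ k′ ] k < k′ × f k ≡ f k′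
vec-pigeonhole {n} f with i , j , i<j , e ← pigeonhole (n<1+n (2 ^ n)) (vecToFin ∘ f ∘ toℕ) =
  toℕ i , toℕ j , i<j , vecToFin-injective e

does-≡⇒⇔ : ∀ {P Q : Set} (p : Dec P) (q : Dec Q) → does p ≡ does q → P ⇔ Q
does-≡⇒⇔ (yes p) (yes q) _ = mk⇔ (λ _ → q) (λ _ → p)
does-≡⇒⇔ (no ¬p) (no ¬q) _ = mk⇔ (⊥-elim ∘ ¬p) (⊥-elim ∘ ¬q)

record IsMex (S : ℕ → Set) (m : ℕ) : Set where
  field
    missing : ¬ S m
    covered : ∀ {h} → h < m → S h

open IsMex

IsMex-unique : ∀ {S m m′} → IsMex S m → IsMex S m′ → m ≡ m′
IsMex-unique {m = m} {m′} mex mex′ with <-cmp m m′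
... | tri< m<m′ _ _ = ⊥-elim (missing mex (covered mex′ m<m′))
... | tri≈ _ m≡m′ _ = m≡m′
... | tri> _ _ m′<m = ⊥-elim (missing mex′ (covered mex m′<m))

IsMex-resp : ∀ {S S′ m} → (∀ {h} → S h ⇔ S′ h) → IsMex S m → IsMex S′ m
IsMex-resp S⇔S′ mex = record
  { missing = missing mex ∘ Equivalence.from S⇔S′
  ; covered = Equivalence.to S⇔S′ ∘ covered mex
  }

all<-suc : ∀ {S : ℕ → Set} {n} → (∀ {h} → h < n → S h) → S n →
  ∀ {h} → h < suc n → S h
all<-suc S<n Sn h<1+n with m≤n⇒m<n∨m≡n (s≤s⁻¹ h<1+n)
... | inj₁ h<n = S<n h<n
... | inj₂ refl = Sn

-- When the fuel runs out n cannot be a member: 0, …, n would then be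
-- n + 1 > length xs distinct members.
mexFrom-isMex : ∀ f n xs → length xs ≤ n + f → (∀ {h} → h < n → h ∈ xs) →
  IsMex (_∈ xs) (mexFrom f n xs)
mexFrom-isMex zero n xs len≤ present = record { missing = n∉xs ; covered = present }
  where
  n∉xs : ¬ n ∈ xs
  n∉xs n∈xs = <⇒≱ (covers⇒≤length xs (all<-suc present n∈xs))
                   (subst (length xs ≤_) (+-identityʳ n) len≤)
mexFrom-isMex (suc f) n xs len≤ present with Any.any? (n ≟_) xs
... | no n∉xs = record { missing = n∉xs ; covered = present }
... | yes n∈xs =
  mexFrom-isMex f (suc n) xs (subst (length xs ≤_) (+-suc n f) len≤) (all<-suc present n∈xs)

mex-isMex : ∀ xs → IsMex (_∈ xs) (mex xs)
mex-isMex xs = mexFrom-isMex (length xs) 0 xs ≤-refl (λ ())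

-- Sequences defined by a mex recurrence

-- The saltus equals the period: this is the form in which periodicity propagates
-- through mex recurrences.
AddPeriodicFrom : ℕ → ℕ → (ℕ → ℕ) → Set
AddPeriodicFrom N π b = ∀ n → N ≤ n → b (n + π) ≡ b n + π

EventuallyAddPeriodic : (ℕ → ℕ) → Set
EventuallyAddPeriodic b = ∃[ N ] ∃[ π ] 1 ≤ π × AddPeriodicFrom N π b

PeriodicPermutation : (ℕ → ℕ) → Set
PeriodicPermutation a = (∀ g → ∃[ n ] a n ≡ g) × Injective _≡_ _≡_ a × EventuallyAddPeriodic a

AddPeriodicFrom-mono : ∀ {N N′ π b} → N ≤ N′ → AddPeriodicFrom N π b → AddPeriodicFrom N′ π b
AddPeriodicFrom-mono N≤N′ per n N′≤n = per n (≤-trans N≤N′ N′≤n)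

AddPeriodicFrom-* : ∀ {N π b} c → AddPeriodicFrom N π b → AddPeriodicFrom N (c * π) b
AddPeriodicFrom-* {b = b} zero _ n _ = trans (cong b (+-identityʳ n)) (sym (+-identityʳ (b n)))
AddPeriodicFrom-* {π = π} {b} (suc c) per n N≤n = begin
  b (n + (π + c * π))   ≡⟨ cong b (x∙yz≈xz∙y n π (c * π)) ⟩
  b (n + c * π + π)     ≡⟨ per (n + c * π) (≤-trans N≤n (m≤m+n n (c * π))) ⟩
  b (n + c * π) + π     ≡⟨ cong (_+ π) (AddPeriodicFrom-* c per n N≤n) ⟩
  b n + c * π + π       ≡⟨ x∙yz≈xz∙y (b n) π (c * π) ⟨
  b n + (π + c * π)     ∎
  where open ≡-Reasoning

common-period : ∀ {K} (bs : Fin K → ℕ → ℕ) → (∀ i → EventuallyAddPeriodic (bs i)) →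
  ∃[ N ] ∃[ P ] 1 ≤ P × (∀ i → AddPeriodicFrom N P (bs i))
common-period {zero} bs _ = 0 , 1 , ≤-refl , λ ()
common-period {suc K} bs per
  with N , P , 1≤P , per-suc ← common-period (bs ∘ Fin.suc) (per ∘ Fin.suc)
     | N₀ , π₀ , 1≤π₀ , per-zero ← per Fin.zero
  = N₀ + N , P * π₀ , *-mono-≤ 1≤P 1≤π₀ , per′
  where
  per′ : ∀ i → AddPeriodicFrom (N₀ + N) (P * π₀) (bs i)
  per′ Fin.zero = AddPeriodicFrom-mono {b = bs Fin.zero} (m≤m+n N₀ N) (AddPeriodicFrom-* P per-zero)
  per′ (Fin.suc i) = subst (λ π → AddPeriodicFrom (N₀ + N) π (bs (Fin.suc i))) (*-comm π₀ P)
    (AddPeriodicFrom-mono {b = bs (Fin.suc i)} (m≤n+m N N₀) (AddPeriodicFrom-* π₀ (per-suc i)))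

Earlier : (ℕ → ℕ) → ℕ → ℕ → Set
Earlier a n h = ∃[ j ] j < n × a j ≡ h

Excluded : ∀ {K} → (ℕ → ℕ) → (Fin K → ℕ → ℕ) → ℕ → ℕ → Set
Excluded a bs n h = Earlier a n h ⊎ ∃[ i ] bs i n ≡ h

∃-+ʳ : ∀ {m n} → m ≤ n → ∃[ d ] d + m ≡ n
∃-+ʳ {m} {n} m≤n = n ∸ m , m∸n+n≡m m≤n

module MexRecurrence {K} (a : ℕ → ℕ) (bs : Fin K → ℕ → ℕ)
  (a-isMex : ∀ n → 1 ≤ n → IsMex (Excluded a bs n) (a n))
  (bs-injective : ∀ i → Injective _≡_ _≡_ (bs i))
  (bs-periodic : ∀ i → EventuallyAddPeriodic (bs i))
  where

  Earlier? : ∀ n h → Dec (Earlier a n h)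
  Earlier? n h = anyUpTo? (λ j → a j ≟ h) n

  Earlier-mono : ∀ {n n′ h} → n ≤ n′ → Earlier a n h → Earlier a n′ h
  Earlier-mono n≤n′ (j , j<n , e) = j , <-≤-trans j<n n≤n′ , e

  Earlier-suc : ∀ {n h} → Earlier a (suc n) h ⇔ (Earlier a n h ⊎ a n ≡ h)
  Earlier-suc {n} {h} = mk⇔ to from
    where
    to : Earlier a (suc n) h → Earlier a n h ⊎ a n ≡ h
    to (j , j<1+n , e) with m≤n⇒m<n∨m≡n (s≤s⁻¹ j<1+n)
    ... | inj₁ j<n = inj₁ (j , j<n , e)
    ... | inj₂ refl = inj₂ e
    from : Earlier a n h ⊎ a n ≡ h → Earlier a (suc n) h
    from (inj₁ earlier) = Earlier-mono (n≤1+n n) earlier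
    from (inj₂ e) = n , ≤-refl , e

  a-not-earlier : ∀ {n} → 1 ≤ n → ¬ Earlier a n (a n)
  a-not-earlier {n} 1≤n = missing (a-isMex n 1≤n) ∘ inj₁

  a-injective : Injective _≡_ _≡_ a
  a-injective {m} {n} e with <-cmp m n
  ... | tri< m<n _ _ = ⊥-elim (a-not-earlier (≤-trans (s≤s z≤n) m<n) (m , m<n , e))
  ... | tri≈ _ m≡n _ = m≡n
  ... | tri> _ _ n<m = ⊥-elim (a-not-earlier (≤-trans (s≤s z≤n) n<m) (n , n<m , sym e))

  -- Each value below a n is an earlier a j or some bs i n: at most n + K of them.
  a-≤ : ∀ {n} → 1 ≤ n → a n ≤ n + K
  a-≤ {n} 1≤n = injective-below⇒≤ (λ _ p → label (reason p))
    (λ _ p → label-< (reason p)) (λ _ _ p q → label-injective (reason p) (reason q))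
    where
    reason : ∀ {h} → h < a n → Excluded a bs n h
    reason = covered (a-isMex n 1≤n)
    label : ∀ {h} → Excluded a bs n h → ℕ
    label (inj₁ (j , _)) = j
    label (inj₂ (i , _)) = n + toℕ i
    label-< : ∀ {h} (e : Excluded a bs n h) → label e < n + K
    label-< (inj₁ (j , j<n , _)) = ≤-trans j<n (m≤m+n n K)
    label-< (inj₂ (i , _)) = +-monoʳ-< n (toℕ<n i)
    label-injective : ∀ {h h′} (e : Excluded a bs n h) (e′ : Excluded a bs n h′) →
      label e ≡ label e′ → h ≡ h′
    label-injective (inj₁ (_ , _ , refl)) (inj₁ (_ , _ , refl)) refl = refl
    label-injective (inj₁ (_ , j<n , _)) (inj₂ (i , _)) refl = ⊥-elim (<⇒≱ j<n (m≤m+n n (toℕ i)))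
    label-injective (inj₂ (i , _)) (inj₁ (_ , j<n , _)) refl = ⊥-elim (<⇒≱ j<n (m≤m+n n (toℕ i)))
    label-injective (inj₂ (i , refl)) (inj₂ (i′ , refl)) e =
      cong (λ i → bs i n) (toℕ-injective (+-cancelˡ-≡ n _ _ e))

  U : ℕ
  U = K + a 0

  a-≤-+U : ∀ j → a j ≤ j + U
  a-≤-+U zero = m≤n+m (a 0) K
  a-≤-+U (suc j) = ≤-trans (a-≤ (s≤s z≤n)) (+-monoʳ-≤ (suc j) (m≤m+n K (a 0)))

  earlier-< : ∀ {n h} → Earlier a n h → h < n + U
  earlier-< (j , j<n , refl) = ≤-<-trans (a-≤-+U j) (+-monoˡ-< U j<n)

  -- Each index 1 ≤ j ≤ n at which x is not yet taken has a j < x, or x = bs i j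
  -- for some i; the second happens at most once per i since bs i is injective.
  not-earlier⇒≤ : ∀ {n x} → ¬ Earlier a (suc n) x → n ≤ x + K
  not-earlier⇒≤ {n} {x} x-new = injective-below⇒≤ (λ _ p → label (classify′ p))
    (λ _ p → label-< (classify′ p))
    (λ _ _ p q → suc-injective ∘ label-injective (classify′ p) (classify′ q))
    where
    Placed : ℕ → Set
    Placed j = a j < x ⊎ ∃[ i ] bs i j ≡ x
    classify : ∀ {j} → 1 ≤ j → j < suc n → Placed j
    classify {j} 1≤j j<1+n with <-cmp (a j) x
    ... | tri< aj<x _ _ = inj₁ aj<x
    ... | tri≈ _ aj≡x _ = ⊥-elim (x-new (j , j<1+n , aj≡x))
    ... | tri> _ _ x<aj with covered (a-isMex j 1≤j) x<aj
    ...   | inj₁ earlier = ⊥-elim (x-new (Earlier-mono (<⇒≤ j<1+n) earlier))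
    ...   | inj₂ hit = inj₂ hit
    classify′ : ∀ {j} → j < n → Placed (suc j)
    classify′ j<n = classify (s≤s z≤n) (s<s j<n)
    label : ∀ {j} → Placed j → ℕ
    label {j} (inj₁ _) = a j
    label (inj₂ (i , _)) = x + toℕ i
    label-< : ∀ {j} (p : Placed j) → label p < x + K
    label-< (inj₁ aj<x) = ≤-trans aj<x (m≤m+n x K)
    label-< (inj₂ (i , _)) = +-monoʳ-< x (toℕ<n i)
    label-injective : ∀ {j j′} (p : Placed j) (p′ : Placed j′) → label p ≡ label p′ → j ≡ j′
    label-injective (inj₁ _) (inj₁ _) e = a-injective e
    label-injective (inj₁ aj<x) (inj₂ (i , _)) e =
      ⊥-elim (<⇒≱ aj<x (subst (x ≤_) (sym e) (m≤m+n x (toℕ i))))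
    label-injective (inj₂ (i , _)) (inj₁ aj<x) e =
      ⊥-elim (<⇒≱ aj<x (subst (x ≤_) e (m≤m+n x (toℕ i))))
    label-injective (inj₂ (i , e)) (inj₂ (i′ , e′)) eq
      with refl ← toℕ-injective (+-cancelˡ-≡ x _ _ eq) = bs-injective i (trans e (sym e′))

  L : ℕ
  L = suc (suc K)

  earlier-≥ : ∀ {x n} → x + L ≤ n → Earlier a n x
  earlier-≥ {x} {n} x+L≤n with subst (_≤ n) (trans (+-suc x (suc K)) (cong suc (+-suc x K))) x+L≤n
  ... | s≤s {n = n′} x+K<n′ with Earlier? (suc n′) x
  ...   | yes earlier = earlier
  ...   | no x-new = ⊥-elim (<⇒≱ x+K<n′ (not-earlier⇒≤ x-new))

  a-surjective : ∀ g → ∃[ n ] a n ≡ g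
  a-surjective g with j , _ , e ← earlier-≥ {g} {g + L} ≤-refl = j , e

  1≤+L : ∀ t → 1 ≤ t + L
  1≤+L t = ≤-trans (s≤s z≤n) (m≤n+m L t)

  -- From time t + L on, every value below t has been taken (earlier-≥), so the
  -- future of a is governed by the values ≥ t taken so far, and the phase of the bs.
  Aligned : ℕ → ℕ → Set
  Aligned t π = ∀ h → t ≤ h → Earlier a (t + L) h ⇔ Earlier a (t + L + π) (h + π)

  module _ {N π} (bs-shift : ∀ i → AddPeriodicFrom N π (bs i))
           {t} (N≤t : N ≤ t) (aligned : Aligned t π) where

    private
      n = t + L
      bs-at-n+π : ∀ i → bs i (n + π) ≡ bs i n + π
      bs-at-n+π i = bs-shift i n (≤-trans N≤t (m≤m+n t L))
      t≤an : t ≤ a n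
      t≤an = ≮⇒≥ λ an<t → a-not-earlier (1≤+L t) (earlier-≥ (+-monoˡ-≤ L (<⇒≤ an<t)))

    step-isMex : IsMex (Excluded a bs (n + π)) (a n + π)
    step-isMex = record { missing = not-excluded ; covered = excluded-below }
      where
      not-excluded : ¬ Excluded a bs (n + π) (a n + π)
      not-excluded (inj₁ earlier) = a-not-earlier (1≤+L t) (Equivalence.from (aligned (a n) t≤an) earlier)
      not-excluded (inj₂ (i , e)) =
        missing (a-isMex n (1≤+L t)) (inj₂ (i , +-cancelʳ-≡ π _ _ (trans (sym (bs-at-n+π i)) e)))
      excluded-below : ∀ {h} → h < a n + π → Excluded a bs (n + π) h
      excluded-below {h} h<an+π with h <? t + π
      ... | yes h<t+π =
        inj₁ (earlier-≥ (subst (h + L ≤_) (xy∙z≈xz∙y t π L) (+-monoˡ-≤ L (<⇒≤ h<t+π))))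
      ... | no h≮t+π with h₀ , refl ← ∃-+ʳ (≤-trans (m≤n+m π t) (≮⇒≥ h≮t+π))
        with covered (a-isMex n (1≤+L t)) (+-cancelʳ-< π h₀ (a n) h<an+π)
      ...   | inj₁ earlier = inj₁ (Equivalence.to (aligned h₀ (+-cancelʳ-≤ π t h₀ (≮⇒≥ h≮t+π))) earlier)
      ...   | inj₂ (i , e) = inj₂ (i , trans (bs-at-n+π i) (cong (_+ π) e))

    step-value : a (n + π) ≡ a n + π
    step-value = IsMex-unique (a-isMex (n + π) (≤-trans (1≤+L t) (m≤m+n n π))) step-isMex

    step-aligned : Aligned (suc t) π
    step-aligned h 1+t≤h = ⇔-trans Earlier-suc
      (⇔-trans (aligned h (≤-trans (n≤1+n t) 1+t≤h) ⊎-⇔ shift-≡) (⇔-sym Earlier-suc))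
      where
      shift-≡ : (a n ≡ h) ⇔ (a (n + π) ≡ h + π)
      shift-≡ = mk⇔ (λ e → trans step-value (cong (_+ π) e))
                    (λ e → +-cancelʳ-≡ π _ _ (trans (sym step-value) e))

  W : ℕ
  W = L + U

  inWindow : ℕ → ℕ → Bool
  inWindow t i = does (Earlier? (t + L) (t + i))

  window : ℕ → Vec Bool W
  window t = tabulate (inWindow t ∘ toℕ)

  lookup-window : ∀ t {i} (i<W : i < W) → Vec.lookup (window t) (fromℕ< i<W) ≡ inWindow t i
  lookup-window t i<W =
    trans (lookup∘tabulate (inWindow t ∘ toℕ) (fromℕ< i<W)) (cong (inWindow t) (toℕ-fromℕ< i<W))

  earlier-in-window : ∀ {t i} → Earlier a (t + L) (t + i) → i < W
  earlier-in-window {t} {i} earlier = +-cancelˡ-< t i W (subst (t + i <_) (+-assoc t L U) (earlier-< earlier))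

  sameWindow⇒⇔ : ∀ {t t′} → window t ≡ window t′ → ∀ i →
    Earlier a (t + L) (t + i) ⇔ Earlier a (t′ + L) (t′ + i)
  sameWindow⇒⇔ {t} {t′} same i with i <? W
  ... | yes i<W = does-≡⇒⇔ (Earlier? (t + L) (t + i)) (Earlier? (t′ + L) (t′ + i)) (begin
    inWindow t i                            ≡⟨ lookup-window t i<W ⟨
    Vec.lookup (window t) (fromℕ< i<W)      ≡⟨ cong (λ w → Vec.lookup w (fromℕ< i<W)) same ⟩
    Vec.lookup (window t′) (fromℕ< i<W)     ≡⟨ lookup-window t′ i<W ⟩
    inWindow t′ i                           ∎)
    where open ≡-Reasoning
  ... | no i≮W = mk⇔ (⊥-elim ∘ i≮W ∘ earlier-in-window) (⊥-elim ∘ i≮W ∘ earlier-in-window)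

  sameWindow⇒aligned : ∀ {t π} → window t ≡ window (t + π) → Aligned t π
  sameWindow⇒aligned {t} {π} same h t≤h with i , refl ← m≤n⇒∃[o]m+o≡n t≤h =
    subst₂ (λ n h → Earlier a (t + L) (t + i) ⇔ Earlier a n h) (xy∙z≈xz∙y t π L) (xy∙z≈xz∙y t π i)
      (sameWindow⇒⇔ same i)

  -- Sample the window along the progression N + k P, on which every bs i is
  -- already periodic with period P; two samples agree, and alignment propagates.
  a-eventuallyAddPeriodic : EventuallyAddPeriodic a
  a-eventuallyAddPeriodic
    with N , P , 1≤P , bs-periodicFrom ← common-period bs bs-periodic
    with k , k′ , k<k′ , same ← vec-pigeonhole (λ k → window (N + k * P))
    = t₀ + L , π , 1≤π , a-periodicFrom
    where
    t₀ π : ℕ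
    t₀ = N + k * P
    π = (k′ ∸ k) * P
    1≤π : 1 ≤ π
    1≤π = *-mono-≤ (m<n⇒0<n∸m k<k′) 1≤P
    t₀+π : N + k′ * P ≡ t₀ + π
    t₀+π = begin
      N + k′ * P                   ≡⟨ cong (λ m → N + m * P) (m+[n∸m]≡n (<⇒≤ k<k′)) ⟨
      N + (k + (k′ ∸ k)) * P       ≡⟨ cong (λ m → N + m) (*-distribʳ-+ P k (k′ ∸ k)) ⟩
      N + (k * P + π)              ≡⟨ +-assoc N (k * P) π ⟨
      t₀ + π                       ∎
      where open ≡-Reasoning
    bs-shift : ∀ i → AddPeriodicFrom N π (bs i)
    bs-shift i = AddPeriodicFrom-* {b = bs i} (k′ ∸ k) (bs-periodicFrom i)
    N≤ : ∀ d → N ≤ d + t₀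
    N≤ d = ≤-trans (m≤m+n N (k * P)) (m≤n+m t₀ d)
    aligned : ∀ d → Aligned (d + t₀) π
    aligned zero = sameWindow⇒aligned (subst (λ t → window t₀ ≡ window t) t₀+π same)
    aligned (suc d) = step-aligned bs-shift (N≤ d) (aligned d)
    a-periodicFrom : AddPeriodicFrom (t₀ + L) π a
    a-periodicFrom n t₀+L≤n with d , refl ← ∃-+ʳ t₀+L≤n =
      subst (λ n → a (n + π) ≡ a n + π) (+-assoc d t₀ L) (step-value bs-shift (N≤ d) (aligned d))

  a-periodicPermutation : PeriodicPermutation a
  a-periodicPermutation = a-surjective , a-injective , a-eventuallyAddPeriodic

-- Moves, sizes and Grundy values

∈-++-map⁻ : ∀ {A B : Set} (xs : List A) (f : B → A) {ys : List B} {x} →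
  x ∈ xs ++ map f ys → x ∈ xs ⊎ ∃[ y ] y ∈ ys × x ≡ f y
∈-++-map⁻ xs f x∈ with ∈-++⁻ xs x∈
... | inj₁ x∈xs = inj₁ x∈xs
... | inj₂ x∈ys = inj₂ (∈-map⁻ f x∈ys)

∈-childMoves⁻ : ∀ k ts {x} → x ∈ childMoves (node k ts) →
  x ∈ leafPart k ts ⊎ ∃[ ys ] ys ∈ forestMoves ts × x ≡ just (node k ys)
∈-childMoves⁻ k ts = ∈-++-map⁻ (leafPart k ts) _

∈-childMoves⁺ : ∀ k ts {ys} → ys ∈ forestMoves ts → just (node k ys) ∈ childMoves (node k ts)
∈-childMoves⁺ k ts ys∈ = ∈-++⁺ʳ (leafPart k ts) (∈-map⁺ _ ys∈)

∈-options⁻ : ∀ k ts {q} → q ∈ options (node k ts) →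
  q ∈ rootPart k ts ⊎ ∃[ ys ] ys ∈ forestMoves ts × q ≡ just (node k ys)
∈-options⁻ k ts = ∈-++-map⁻ (rootPart k ts) _

childMoves⊆options : ∀ {k ts x} → leafPart k ts ≡ [] →
  x ∈ childMoves (node k ts) → x ∈ options (node k ts)
childMoves⊆options {k} {ts} noLeaf x∈ = ∈-++⁺ʳ (rootPart k ts)
  (subst (λ l → _ ∈ l ++ map (λ ys → just (node k ys)) (forestMoves ts)) noLeaf x∈)

replaceHead : List Tree → Maybe Tree → List Tree
replaceHead ts nothing = ts
replaceHead ts (just t) = t ∷ ts

-- The definition with a named function in place of its pattern lambda, which
-- computes only on constructors.
forestMoves-∷ : ∀ t ts →
  forestMoves (t ∷ ts) ≡ map (replaceHead ts) (childMoves t) ++ map (t ∷_) (forestMoves ts)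
forestMoves-∷ t ts = cong (_++ map (t ∷_) (forestMoves ts))
  (map-cong (λ { nothing → refl ; (just _) → refl }) (childMoves t))

∈-forestMoves-∷⁻ : ∀ t ts {xs} → xs ∈ forestMoves (t ∷ ts) →
  (∃[ w ] w ∈ childMoves t × xs ≡ replaceHead ts w) ⊎ (∃[ ys ] ys ∈ forestMoves ts × xs ≡ t ∷ ys)
∈-forestMoves-∷⁻ t ts xs∈ with ∈-++-map⁻ _ _ (subst (_ ∈_) (forestMoves-∷ t ts) xs∈)
... | inj₁ xs∈′ = inj₁ (∈-map⁻ _ xs∈′)
... | inj₂ xs∈′ = inj₂ xs∈′

∈-forestMoves-∷⁺ʰ : ∀ t ts {w} → w ∈ childMoves t → replaceHead ts w ∈ forestMoves (t ∷ ts)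
∈-forestMoves-∷⁺ʰ t ts w∈ = subst (_ ∈_) (sym (forestMoves-∷ t ts)) (∈-++⁺ˡ (∈-map⁺ _ w∈))

∈-forestMoves-∷⁺ᵗ : ∀ t ts {ys} → ys ∈ forestMoves ts → t ∷ ys ∈ forestMoves (t ∷ ts)
∈-forestMoves-∷⁺ᵗ t ts ys∈ = subst (_ ∈_) (sym (forestMoves-∷ t ts)) (∈-++⁺ʳ _ (∈-map⁺ _ ys∈))

vertexOfSize : ℕ → Position
vertexOfSize zero = nothing
vertexOfSize (suc m) = just (node m [])

∈-leafPart-[]⁻ : ∀ {m x} → x ∈ leafPart m [] → ∃[ j ] j < suc m × x ≡ vertexOfSize j
∈-leafPart-[]⁻ (here refl) = 0 , z<s , refl
∈-leafPart-[]⁻ (there x∈) with j , j∈ , refl ← ∈-map⁻ _ x∈ = suc j , s<s (∈-downFrom⁻ j∈) , refl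

∈-leafPart-[]⁺ : ∀ {m j} → j < suc m → vertexOfSize j ∈ leafPart m []
∈-leafPart-[]⁺ {j = zero} _ = here refl
∈-leafPart-[]⁺ {j = suc j} j<1+m = there (∈-map⁺ _ (∈-downFrom⁺ (s<s⁻¹ j<1+m)))

size-vertexOfSize : ∀ j → size (vertexOfSize j) ≡ j
size-vertexOfSize zero = refl
size-vertexOfSize (suc j) = cong suc (+-identityʳ j)

∈-childMoves-vertex⁻ : ∀ {m w} → w ∈ childMoves (node m []) → ∃[ j ] j < suc m × w ≡ vertexOfSize j
∈-childMoves-vertex⁻ {m} w∈ with ∈-childMoves⁻ m [] w∈
... | inj₁ w∈leaf = ∈-leafPart-[]⁻ w∈leaf

∈-childMoves-vertex⁺ : ∀ {m j} → j < suc m → vertexOfSize j ∈ childMoves (node m [])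
∈-childMoves-vertex⁺ j<1+m = ∈-++⁺ˡ (∈-leafPart-[]⁺ j<1+m)

leafPart-[]-lighter : ∀ {m x} → x ∈ leafPart m [] → size x < suc m + 0
leafPart-[]-lighter x∈ with j , j<1+m , refl ← ∈-leafPart-[]⁻ x∈ =
  subst₂ _<_ (sym (size-vertexOfSize j)) (sym (+-identityʳ _)) j<1+m

mutual
  childMoves-lighter : ∀ t {x} → x ∈ childMoves t → size x < weight t
  childMoves-lighter (node k ts) x∈ with ∈-childMoves⁻ k ts x∈
  childMoves-lighter (node k []) _ | inj₁ x∈leaf = leafPart-[]-lighter x∈leaf
  ... | inj₂ (ys , ys∈ , refl) = +-monoʳ-< (suc k) (forestMoves-lighter ts ys∈)

  forestMoves-lighter : ∀ ts {ys} → ys ∈ forestMoves ts → weightF ys < weightF ts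
  forestMoves-lighter (t ∷ ts) ys∈ with ∈-forestMoves-∷⁻ t ts ys∈
  ... | inj₁ (nothing , x∈ , refl) = m<n+m (weightF ts) (childMoves-lighter t x∈)
  ... | inj₁ (just _ , x∈ , refl) = +-monoˡ-< (weightF ts) (childMoves-lighter t x∈)
  ... | inj₂ (zs , zs∈ , refl) = +-monoʳ-< (weight t) (forestMoves-lighter ts zs∈)

rootPart-lighter : ∀ k ts {q} → q ∈ rootPart k ts → size q < weight (node k ts)
rootPart-lighter k [] q∈ = leafPart-[]-lighter q∈
rootPart-lighter k (c ∷ []) (here refl) = s≤s (≤-trans (m≤m+n (weight c) 0) (m≤n+m _ k))
rootPart-lighter k (c ∷ []) (there q∈) with j , j∈ , refl ← ∈-map⁻ _ q∈ =
  s≤s (+-monoˡ-≤ (weight c + 0) (∈-downFrom⁻ j∈))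

options-lighter : ∀ t {q} → q ∈ options t → size q < weight t
options-lighter (node k ts) q∈ with ∈-options⁻ k ts q∈
... | inj₁ q∈root = rootPart-lighter k ts q∈root
... | inj₂ (ys , ys∈ , refl) = +-monoʳ-< (suc k) (forestMoves-lighter ts ys∈)

weightF-++ : ∀ ts u → weightF (ts ++ [ u ]) ≡ weightF ts + weight u
weightF-++ [] u = +-comm (weight u) 0
weightF-++ (c ∷ cs) u =
  trans (cong (λ w → weight c + w) (weightF-++ cs u)) (sym (+-assoc (weight c) (weightF cs) (weight u)))

mutual
  weight-attach : ∀ t v u → weight (attach t v u) ≡ weight t + weight u
  weight-attach (node k ts) root u =
    trans (cong (λ w → suc k + w) (weightF-++ ts u)) (sym (+-assoc (suc k) (weightF ts) (weight u)))
  weight-attach (node k ts) (below p) u =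
    trans (cong (λ w → suc k + w) (weightF-attachAny ts p u)) (sym (+-assoc (suc k) (weightF ts) (weight u)))

  weightF-attachAny : ∀ ts p u → weightF (attachAny ts p u) ≡ weightF ts + weight u
  weightF-attachAny (c ∷ cs) (here p) u =
    trans (cong (_+ weightF cs) (weight-attach c p u)) (xy∙z≈xz∙y (weight c) (weight u) (weightF cs))
  weightF-attachAny (c ∷ cs) (there p) u =
    trans (cong (λ w → weight c + w) (weightF-attachAny cs p u)) (sym (+-assoc (weight c) (weightF cs) (weight u)))

grundyF-fuel : ∀ f g p → size p ≤ f → size p ≤ g → grundyF f p ≡ grundyF g p
grundyF-fuel _ _ nothing _ _ = refl
grundyF-fuel zero _ (just (node _ _)) () _
grundyF-fuel (suc _) zero (just (node _ _)) _ ()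
grundyF-fuel (suc f) (suc g) (just t) p≤1+f p≤1+g = cong mex (map-cong-local (All.tabulate λ {q} q∈ →
  grundyF-fuel f g q (s≤s⁻¹ (≤-trans (options-lighter t q∈) p≤1+f))
                     (s≤s⁻¹ (≤-trans (options-lighter t q∈) p≤1+g))))

grundy-unfold : ∀ t → grundy (just t) ≡ mex (map grundy (options t))
grundy-unfold (node k ts) = cong mex (map-cong-local (All.tabulate λ {q} q∈ →
  grundyF-fuel _ _ q (s≤s⁻¹ (options-lighter (node k ts) q∈)) ≤-refl))

OptionValue : Tree → ℕ → Set
OptionValue t h = ∃[ q ] q ∈ options t × grundy q ≡ h

grundy-isMex : ∀ t → IsMex (OptionValue t) (grundy (just t))
grundy-isMex t = subst (IsMex (OptionValue t)) (sym (grundy-unfold t))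
  (IsMex-resp (mk⇔ from-map to-map) (mex-isMex (map grundy (options t))))
  where
  from-map : ∀ {h} → h ∈ map grundy (options t) → OptionValue t h
  from-map h∈ with q , q∈ , refl ← ∈-map⁻ grundy h∈ = q , q∈ , refl
  to-map : ∀ {h} → OptionValue t h → h ∈ map grundy (options t)
  to-map (q , q∈ , refl) = ∈-map⁺ grundy q∈

grundy-vertexOfSize : ∀ n → grundy (vertexOfSize n) ≡ n
grundy-vertexOfSize = <-rec _ go
  where
  go : ∀ n → (∀ {j} → j < n → grundy (vertexOfSize j) ≡ j) → grundy (vertexOfSize n) ≡ n
  go zero _ = refl
  go (suc m) IH = IsMex-unique (grundy-isMex (node m []))
    (IsMex-resp (mk⇔ to from) (record { missing = <-irrefl refl ; covered = λ h<n → h<n }))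
    where
    to : ∀ {h} → h < suc m → OptionValue (node m []) h
    to {h} h<n = vertexOfSize h , ∈-childMoves-vertex⁺ h<n , IH h<n
    from : ∀ {h} → OptionValue (node m []) h → h < suc m
    from (q , q∈ , refl) with j , j<n , refl ← ∈-childMoves-vertex⁻ q∈ =
      subst (_< suc m) (sym (IH j<n)) j<n

-- Attaching a tree at a vertex

_++?_ : List Tree → Maybe Tree → List Tree
ts ++? nothing = ts
ts ++? just u = ts ++ [ u ]

attachAny? : (ts : List Tree) → Any Vertex ts → Maybe Tree → List Tree
attachAny? ts p nothing = ts
attachAny? ts p (just u) = attachAny ts p u

attach? : (t : Tree) → Vertex t → Maybe Tree → Tree
attach? t v nothing = t
attach? t v (just u) = attach t v u

replaceHeadᵛ : (ts : List Tree) → Any Vertex ts → Maybe Tree → Σ (List Tree) (Any Vertex)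
replaceHeadᵛ ts p nothing = ts , p
replaceHeadᵛ ts p (just t) = t ∷ ts , there p

-- The moves of attach t v u, t a non-root subtree, that are not inside u: they keep
-- v, and do not depend on u.
mutual
  awayMoves : (t : Tree) → Vertex t → List (Σ Tree Vertex)
  awayMoves (node k ts) root = map (λ ys → node k ys , root) (forestMoves ts)
  awayMoves (node k ts) (below p) = map (λ (ys , q) → node k ys , below q) (awayMovesF ts p)

  awayMovesF : (ts : List Tree) → Any Vertex ts → List (Σ (List Tree) (Any Vertex))
  awayMovesF (c ∷ cs) (here p) =
    map (λ (c′ , p′) → c′ ∷ cs , here p′) (awayMoves c p) ++ map (λ ys → c ∷ ys , here p) (forestMoves cs)
  awayMovesF (c ∷ cs) (there p) =
    map (replaceHeadᵛ cs p) (childMoves c) ++ map (λ (ys , q) → c ∷ ys , there q) (awayMovesF cs p)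

data Context : Set where
  hole   : Context
  inside : (t : Tree) → Vertex t → Context

plug : Context → Tree → Position
plug hole u = just u
plug (inside t v) u = just (attach t v u)

-- The root of attach t v u is a leaf only if it is v and has no children in t
-- (deleting it leaves u alone), or its only child contains v.
rootContexts : ∀ k ts → Vertex (node k ts) → List Context
rootContexts k [] root = hole ∷ map (λ m → inside (node m []) root) (downFrom k)
rootContexts k (c ∷ []) (below (here p)) =
  inside c p ∷ map (λ m → inside (node m (c ∷ [])) (below (here p))) (downFrom k)
rootContexts _ _ _ = []

contexts : (t : Tree) → Vertex t → List Context
contexts (node k ts) v =
  rootContexts k ts v ++ map (λ (t′ , v′) → inside t′ v′) (awayMoves (node k ts) v)

children : Tree → List Tree
children (node _ ts) = ts

options⊆rootPart∪childMoves : ∀ {k ts q} → q ∈ options (node k ts) →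
  q ∈ rootPart k ts ⊎ q ∈ childMoves (node k ts)
options⊆rootPart∪childMoves {k} {ts} q∈ with ∈-options⁻ k ts q∈
... | inj₁ q∈root = inj₁ q∈root
... | inj₂ (ys , ys∈ , refl) = inj₂ (∈-childMoves⁺ k ts ys∈)

module _ (u : Tree) where

  leafPart-++ : ∀ k ts → leafPart k (ts ++ [ u ]) ≡ []
  leafPart-++ k [] = refl
  leafPart-++ k (_ ∷ _) = refl

  leafPart-attachAny : ∀ k ts p → leafPart k (attachAny ts p u) ≡ []
  leafPart-attachAny k (_ ∷ _) (here _) = refl
  leafPart-attachAny k (_ ∷ _) (there _) = refl

  ∈-forestMoves-++⁻ : ∀ ts {xs} → xs ∈ forestMoves (ts ++ [ u ]) →
    (∃[ w ] w ∈ childMoves u × xs ≡ ts ++? w) ⊎ (∃[ ys ] ys ∈ forestMoves ts × xs ≡ ys ++ [ u ])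
  ∈-forestMoves-++⁻ [] xs∈ with ∈-forestMoves-∷⁻ u [] xs∈
  ... | inj₁ (nothing , w∈ , e) = inj₁ (nothing , w∈ , e)
  ... | inj₁ (just u′ , w∈ , e) = inj₁ (just u′ , w∈ , e)
  ∈-forestMoves-++⁻ (c ∷ cs) xs∈ with ∈-forestMoves-∷⁻ c (cs ++ [ u ]) xs∈
  ... | inj₁ (nothing , w∈ , refl) = inj₂ (cs , ∈-forestMoves-∷⁺ʰ c cs w∈ , refl)
  ... | inj₁ (just c′ , w∈ , refl) = inj₂ (c′ ∷ cs , ∈-forestMoves-∷⁺ʰ c cs w∈ , refl)
  ... | inj₂ (ys , ys∈ , refl) with ∈-forestMoves-++⁻ cs ys∈
  ...   | inj₁ (nothing , w∈ , refl) = inj₁ (nothing , w∈ , refl)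
  ...   | inj₁ (just u′ , w∈ , refl) = inj₁ (just u′ , w∈ , refl)
  ...   | inj₂ (zs , zs∈ , refl) = inj₂ (c ∷ zs , ∈-forestMoves-∷⁺ᵗ c cs zs∈ , refl)

  ∈-forestMoves-++⁺ᵘ : ∀ ts {w} → w ∈ childMoves u → ts ++? w ∈ forestMoves (ts ++ [ u ])
  ∈-forestMoves-++⁺ᵘ [] {nothing} w∈ = ∈-forestMoves-∷⁺ʰ u [] w∈
  ∈-forestMoves-++⁺ᵘ [] {just _} w∈ = ∈-forestMoves-∷⁺ʰ u [] w∈
  ∈-forestMoves-++⁺ᵘ (c ∷ cs) {nothing} w∈ = ∈-forestMoves-∷⁺ᵗ c (cs ++ [ u ]) (∈-forestMoves-++⁺ᵘ cs w∈)
  ∈-forestMoves-++⁺ᵘ (c ∷ cs) {just _} w∈ = ∈-forestMoves-∷⁺ᵗ c (cs ++ [ u ]) (∈-forestMoves-++⁺ᵘ cs w∈)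

  ∈-forestMoves-++⁺ : ∀ ts {ys} → ys ∈ forestMoves ts → ys ++ [ u ] ∈ forestMoves (ts ++ [ u ])
  ∈-forestMoves-++⁺ (c ∷ cs) ys∈ with ∈-forestMoves-∷⁻ c cs ys∈
  ... | inj₁ (nothing , w∈ , refl) = ∈-forestMoves-∷⁺ʰ c (cs ++ [ u ]) w∈
  ... | inj₁ (just _ , w∈ , refl) = ∈-forestMoves-∷⁺ʰ c (cs ++ [ u ]) w∈
  ... | inj₂ (zs , zs∈ , refl) = ∈-forestMoves-∷⁺ᵗ c (cs ++ [ u ]) (∈-forestMoves-++⁺ cs zs∈)

  mutual
    ∈-childMoves-attach⁻ : ∀ t v {x} → x ∈ childMoves (attach t v u) →
      (∃[ w ] w ∈ childMoves u × x ≡ just (attach? t v w)) ⊎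
      (∃[ s ] s ∈ awayMoves t v × x ≡ just (attach (proj₁ s) (proj₂ s) u))
    ∈-childMoves-attach⁻ (node k ts) root x∈ with ∈-childMoves⁻ k (ts ++ [ u ]) x∈
    ... | inj₁ x∈leaf with () ← subst (_ ∈_) (leafPart-++ k ts) x∈leaf
    ... | inj₂ (ys , ys∈ , refl) with ∈-forestMoves-++⁻ ts ys∈
    ...   | inj₁ (nothing , w∈ , refl) = inj₁ (nothing , w∈ , refl)
    ...   | inj₁ (just _ , w∈ , refl) = inj₁ (just _ , w∈ , refl)
    ...   | inj₂ (zs , zs∈ , refl) = inj₂ ((node k zs , root) , ∈-map⁺ _ zs∈ , refl)
    ∈-childMoves-attach⁻ (node k ts) (below p) x∈ with ∈-childMoves⁻ k (attachAny ts p u) x∈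
    ... | inj₁ x∈leaf with () ← subst (_ ∈_) (leafPart-attachAny k ts p) x∈leaf
    ... | inj₂ (ys , ys∈ , refl) with ∈-forestMoves-attachAny⁻ ts p ys∈
    ...   | inj₁ (nothing , w∈ , refl) = inj₁ (nothing , w∈ , refl)
    ...   | inj₁ (just _ , w∈ , refl) = inj₁ (just _ , w∈ , refl)
    ...   | inj₂ (s , s∈ , refl) = inj₂ ((node k (proj₁ s) , below (proj₂ s)) , ∈-map⁺ _ s∈ , refl)

    ∈-forestMoves-attachAny⁻ : ∀ ts p {xs} → xs ∈ forestMoves (attachAny ts p u) →
      (∃[ w ] w ∈ childMoves u × xs ≡ attachAny? ts p w) ⊎
      (∃[ s ] s ∈ awayMovesF ts p × xs ≡ attachAny (proj₁ s) (proj₂ s) u)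
    ∈-forestMoves-attachAny⁻ (c ∷ cs) (here p) xs∈ with ∈-forestMoves-∷⁻ (attach c p u) cs xs∈
    ... | inj₂ (ys , ys∈ , refl) = inj₂ ((c ∷ ys , here p) , ∈-++⁺ʳ _ (∈-map⁺ _ ys∈) , refl)
    ... | inj₁ (x , x∈ , refl) with ∈-childMoves-attach⁻ c p x∈
    ...   | inj₁ (nothing , w∈ , refl) = inj₁ (nothing , w∈ , refl)
    ...   | inj₁ (just _ , w∈ , refl) = inj₁ (just _ , w∈ , refl)
    ...   | inj₂ (s , s∈ , refl) = inj₂ ((proj₁ s ∷ cs , here (proj₂ s)) , ∈-++⁺ˡ (∈-map⁺ _ s∈) , refl)
    ∈-forestMoves-attachAny⁻ (c ∷ cs) (there p) xs∈ with ∈-forestMoves-∷⁻ c (attachAny cs p u) xs∈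
    ... | inj₁ (nothing , w∈ , refl) = inj₂ ((cs , p) , ∈-++⁺ˡ (∈-map⁺ _ w∈) , refl)
    ... | inj₁ (just c′ , w∈ , refl) = inj₂ ((c′ ∷ cs , there p) , ∈-++⁺ˡ (∈-map⁺ _ w∈) , refl)
    ... | inj₂ (ys , ys∈ , refl) with ∈-forestMoves-attachAny⁻ cs p ys∈
    ...   | inj₁ (nothing , w∈ , refl) = inj₁ (nothing , w∈ , refl)
    ...   | inj₁ (just _ , w∈ , refl) = inj₁ (just _ , w∈ , refl)
    ...   | inj₂ (s , s∈ , refl) = inj₂ ((c ∷ proj₁ s , there (proj₂ s)) , ∈-++⁺ʳ _ (∈-map⁺ _ s∈) , refl)

  mutual
    ∈-childMoves-attach⁺ᵘ : ∀ t v {w} → w ∈ childMoves u → just (attach? t v w) ∈ childMoves (attach t v u)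
    ∈-childMoves-attach⁺ᵘ (node k ts) root {nothing} w∈ =
      ∈-childMoves⁺ k (ts ++ [ u ]) (∈-forestMoves-++⁺ᵘ ts w∈)
    ∈-childMoves-attach⁺ᵘ (node k ts) root {just _} w∈ =
      ∈-childMoves⁺ k (ts ++ [ u ]) (∈-forestMoves-++⁺ᵘ ts w∈)
    ∈-childMoves-attach⁺ᵘ (node k ts) (below p) {nothing} w∈ =
      ∈-childMoves⁺ k (attachAny ts p u) (∈-forestMoves-attachAny⁺ᵘ ts p w∈)
    ∈-childMoves-attach⁺ᵘ (node k ts) (below p) {just _} w∈ =
      ∈-childMoves⁺ k (attachAny ts p u) (∈-forestMoves-attachAny⁺ᵘ ts p w∈)

    ∈-forestMoves-attachAny⁺ᵘ : ∀ ts p {w} → w ∈ childMoves u →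
      attachAny? ts p w ∈ forestMoves (attachAny ts p u)
    ∈-forestMoves-attachAny⁺ᵘ (c ∷ cs) (here p) {nothing} w∈ =
      ∈-forestMoves-∷⁺ʰ (attach c p u) cs (∈-childMoves-attach⁺ᵘ c p w∈)
    ∈-forestMoves-attachAny⁺ᵘ (c ∷ cs) (here p) {just _} w∈ =
      ∈-forestMoves-∷⁺ʰ (attach c p u) cs (∈-childMoves-attach⁺ᵘ c p w∈)
    ∈-forestMoves-attachAny⁺ᵘ (c ∷ cs) (there p) {nothing} w∈ =
      ∈-forestMoves-∷⁺ᵗ c (attachAny cs p u) (∈-forestMoves-attachAny⁺ᵘ cs p w∈)
    ∈-forestMoves-attachAny⁺ᵘ (c ∷ cs) (there p) {just _} w∈ =
      ∈-forestMoves-∷⁺ᵗ c (attachAny cs p u) (∈-forestMoves-attachAny⁺ᵘ cs p w∈)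

  mutual
    ∈-childMoves-attach⁺ᵃ : ∀ t v {s} → s ∈ awayMoves t v →
      just (attach (proj₁ s) (proj₂ s) u) ∈ childMoves (attach t v u)
    ∈-childMoves-attach⁺ᵃ (node k ts) root s∈ with ys , ys∈ , refl ← ∈-map⁻ _ s∈ =
      ∈-childMoves⁺ k (ts ++ [ u ]) (∈-forestMoves-++⁺ ts ys∈)
    ∈-childMoves-attach⁺ᵃ (node k ts) (below p) s∈ with s′ , s′∈ , refl ← ∈-map⁻ _ s∈ =
      ∈-childMoves⁺ k (attachAny ts p u) (∈-forestMoves-attachAny⁺ᵃ ts p s′∈)

    ∈-forestMoves-attachAny⁺ᵃ : ∀ ts p {s} → s ∈ awayMovesF ts p →
      attachAny (proj₁ s) (proj₂ s) u ∈ forestMoves (attachAny ts p u)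
    ∈-forestMoves-attachAny⁺ᵃ (c ∷ cs) (here p) s∈ with ∈-++-map⁻ (map _ (awayMoves c p)) _ s∈
    ... | inj₁ s∈′ with s′ , s′∈ , refl ← ∈-map⁻ _ s∈′ =
      ∈-forestMoves-∷⁺ʰ (attach c p u) cs (∈-childMoves-attach⁺ᵃ c p s′∈)
    ... | inj₂ (ys , ys∈ , refl) = ∈-forestMoves-∷⁺ᵗ (attach c p u) cs ys∈
    ∈-forestMoves-attachAny⁺ᵃ (c ∷ cs) (there p) s∈
      with ∈-++-map⁻ (map (replaceHeadᵛ cs p) (childMoves c)) _ s∈
    ... | inj₁ s∈′ with ∈-map⁻ _ s∈′
    ...   | nothing , w∈ , refl = ∈-forestMoves-∷⁺ʰ c (attachAny cs p u) w∈
    ...   | just _ , w∈ , refl = ∈-forestMoves-∷⁺ʰ c (attachAny cs p u) w∈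
    ∈-forestMoves-attachAny⁺ᵃ (c ∷ cs) (there p) s∈ | inj₂ (s′ , s′∈ , refl) =
      ∈-forestMoves-∷⁺ᵗ c (attachAny cs p u) (∈-forestMoves-attachAny⁺ᵃ cs p s′∈)

  ∈-rootPart-attach⁻ : ∀ k ts v {q} → q ∈ rootPart k (children (attach (node k ts) v u)) →
    ∃[ C ] C ∈ rootContexts k ts v × q ≡ plug C u
  ∈-rootPart-attach⁻ k [] root (here refl) = hole , here refl , refl
  ∈-rootPart-attach⁻ k [] root (there q∈) with m , m∈ , refl ← ∈-map⁻ _ q∈ =
    inside (node m []) root , there (∈-map⁺ _ m∈) , refl
  ∈-rootPart-attach⁻ k (c ∷ []) (below (here p)) (here refl) = inside c p , here refl , refl
  ∈-rootPart-attach⁻ k (c ∷ []) (below (here p)) (there q∈) with m , m∈ , refl ← ∈-map⁻ _ q∈ =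
    inside (node m (c ∷ [])) (below (here p)) , there (∈-map⁺ _ m∈) , refl
  ∈-rootPart-attach⁻ k (_ ∷ []) root ()
  ∈-rootPart-attach⁻ k (_ ∷ _ ∷ _) root ()
  ∈-rootPart-attach⁻ k (_ ∷ _ ∷ _) (below (here _)) ()
  ∈-rootPart-attach⁻ k (_ ∷ _ ∷ _) (below (there (here _))) ()
  ∈-rootPart-attach⁻ k (_ ∷ _ ∷ _) (below (there (there _))) ()

  ∈-rootPart-attach⁺ : ∀ k ts v {C} → C ∈ rootContexts k ts v →
    plug C u ∈ rootPart k (children (attach (node k ts) v u))
  ∈-rootPart-attach⁺ k [] root (here refl) = here refl
  ∈-rootPart-attach⁺ k [] root (there C∈) with m , m∈ , refl ← ∈-map⁻ _ C∈ = there (∈-map⁺ _ m∈)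
  ∈-rootPart-attach⁺ k (c ∷ []) (below (here p)) (here refl) = here refl
  ∈-rootPart-attach⁺ k (c ∷ []) (below (here p)) (there C∈) with m , m∈ , refl ← ∈-map⁻ _ C∈ =
    there (∈-map⁺ _ m∈)
  ∈-rootPart-attach⁺ k (_ ∷ []) root ()
  ∈-rootPart-attach⁺ k (_ ∷ _ ∷ _) root ()
  ∈-rootPart-attach⁺ k (_ ∷ _ ∷ _) (below (here _)) ()
  ∈-rootPart-attach⁺ k (_ ∷ _ ∷ _) (below (there _)) ()

  rootPart-attach⊆options : ∀ k ts v {q} → q ∈ rootPart k (children (attach (node k ts) v u)) →
    q ∈ options (attach (node k ts) v u)
  rootPart-attach⊆options k ts root = ∈-++⁺ˡ
  rootPart-attach⊆options k ts (below p) = ∈-++⁺ˡ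

  childMoves-attach⊆options : ∀ t v {x} → x ∈ childMoves (attach t v u) → x ∈ options (attach t v u)
  childMoves-attach⊆options (node k ts) root = childMoves⊆options (leafPart-++ k ts)
  childMoves-attach⊆options (node k ts) (below p) = childMoves⊆options (leafPart-attachAny k ts p)

  options-attach⊆parts : ∀ k ts v {q} → q ∈ options (attach (node k ts) v u) →
    q ∈ rootPart k (children (attach (node k ts) v u)) ⊎ q ∈ childMoves (attach (node k ts) v u)
  options-attach⊆parts k ts root = options⊆rootPart∪childMoves
  options-attach⊆parts k ts (below p) = options⊆rootPart∪childMoves

  ∈-options-attach⁻ : ∀ t v {q} → q ∈ options (attach t v u) →
    (∃[ w ] w ∈ childMoves u × q ≡ just (attach? t v w)) ⊎ (∃[ C ] C ∈ contexts t v × q ≡ plug C u)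
  ∈-options-attach⁻ (node k ts) v q∈ with options-attach⊆parts k ts v q∈
  ... | inj₁ q∈root with C , C∈ , e ← ∈-rootPart-attach⁻ k ts v q∈root = inj₂ (C , ∈-++⁺ˡ C∈ , e)
  ... | inj₂ q∈child with ∈-childMoves-attach⁻ (node k ts) v q∈child
  ...   | inj₁ inU = inj₁ inU
  ...   | inj₂ (s , s∈ , e) = inj₂ (inside (proj₁ s) (proj₂ s) , ∈-++⁺ʳ _ (∈-map⁺ _ s∈) , e)

  ∈-options-attach⁺ᵘ : ∀ t v {w} → w ∈ childMoves u → just (attach? t v w) ∈ options (attach t v u)
  ∈-options-attach⁺ᵘ t v w∈ = childMoves-attach⊆options t v (∈-childMoves-attach⁺ᵘ t v w∈)

  ∈-options-attach⁺ᶜ : ∀ t v {C} → C ∈ contexts t v → plug C u ∈ options (attach t v u)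
  ∈-options-attach⁺ᶜ (node k ts) v C∈ with ∈-++-map⁻ (rootContexts k ts v) _ C∈
  ... | inj₁ C∈root = rootPart-attach⊆options k ts v (∈-rootPart-attach⁺ k ts v C∈root)
  ... | inj₂ (s , s∈ , refl) =
    childMoves-attach⊆options (node k ts) v (∈-childMoves-attach⁺ᵃ (node k ts) v s∈)

-- Rays

-- plug C u is an option of attach t v u, and both weights are additive in u.
contexts-lighter : ∀ t v {t′ v′} → inside t′ v′ ∈ contexts t v → weight t′ < weight t
contexts-lighter t v {t′} {v′} C∈ = +-cancelʳ-< (weight u) (weight t′) (weight t)
  (subst₂ _<_ (weight-attach t′ v′ u) (weight-attach t v u)
    (options-lighter (attach t v u) (∈-options-attach⁺ᶜ u t v C∈)))
  where
  u = node 0 []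

raySeq : (t : Tree) → Vertex t → ℕ → ℕ
raySeq t v n = grundy (ray t v n)

ray-attach? : ∀ t v n → ray t v n ≡ just (attach? t v (vertexOfSize n))
ray-attach? t v zero = refl
ray-attach? t v (suc m) = refl

contextSeq : Context → ℕ → ℕ
contextSeq hole n = n
contextSeq (inside t v) = raySeq t v

grundy-plug : ∀ C m → grundy (plug C (node m [])) ≡ contextSeq C (suc m)
grundy-plug hole m = grundy-vertexOfSize (suc m)
grundy-plug (inside t v) m = refl

ray-isMex : ∀ t v n → 1 ≤ n →
  IsMex (Excluded (raySeq t v) (contextSeq ∘ lookup (contexts t v)) n) (raySeq t v n)
ray-isMex t v (suc m) _ = IsMex-resp (mk⇔ to from) (grundy-isMex (attach t v u))
  where
  u = node m []
  Cs = contexts t v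
  to : ∀ {h} → OptionValue (attach t v u) h → Excluded (raySeq t v) (contextSeq ∘ lookup Cs) (suc m) h
  to (q , q∈ , refl) with ∈-options-attach⁻ u t v q∈
  ... | inj₁ (w , w∈ , refl) with j , j<1+m , refl ← ∈-childMoves-vertex⁻ w∈ =
    inj₁ (j , j<1+m , cong grundy (ray-attach? t v j))
  ... | inj₂ (C , C∈ , refl) =
    inj₂ (Any.index C∈ ,
          trans (cong (λ C → contextSeq C (suc m)) (sym (lookup-index C∈))) (sym (grundy-plug C m)))
  from : ∀ {h} → Excluded (raySeq t v) (contextSeq ∘ lookup Cs) (suc m) h → OptionValue (attach t v u) h
  from (inj₁ (j , j<1+m , refl)) =
    ray t v j , subst (_∈ options (attach t v u)) (sym (ray-attach? t v j))
                  (∈-options-attach⁺ᵘ u t v (∈-childMoves-vertex⁺ j<1+m)) , refl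
  from (inj₂ (i , refl)) =
    plug (lookup Cs i) u , ∈-options-attach⁺ᶜ u t v (∈-lookup i) , grundy-plug (lookup Cs i) m

id-periodicPermutation : PeriodicPermutation (λ n → n)
id-periodicPermutation = (λ g → g , refl) , (λ e → e) , 0 , 1 , ≤-refl , λ _ _ → refl

ray-periodicPermutation : ∀ t v → PeriodicPermutation (raySeq t v)
ray-periodicPermutation = WF.All.wfRec (On.wellFounded weight <-wellFounded) 0ℓ
  (λ t → ∀ v → PeriodicPermutation (raySeq t v)) step
  where
  step : ∀ t → (∀ {t′} → weight t′ < weight t → ∀ v′ → PeriodicPermutation (raySeq t′ v′)) →
    ∀ v → PeriodicPermutation (raySeq t v)
  step t IH v = MexRecurrence.a-periodicPermutation (raySeq t v) bs (ray-isMex t v)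
    (proj₁ ∘ proj₂ ∘ bs-periodicPermutation) (proj₂ ∘ proj₂ ∘ bs-periodicPermutation)
    where
    bs = contextSeq ∘ lookup (contexts t v)
    context-periodicPermutation : ∀ C → C ∈ contexts t v → PeriodicPermutation (contextSeq C)
    context-periodicPermutation hole _ = id-periodicPermutation
    context-periodicPermutation (inside t′ v′) C∈ = IH (contexts-lighter t v C∈) v′
    bs-periodicPermutation : ∀ i → PeriodicPermutation (bs i)
    bs-periodicPermutation i = context-periodicPermutation _ (∈-lookup i)

periodicPermutation⇒integerSaltus : ∀ {a} → PeriodicPermutation a →
  ((g : ℕ) → ∃[ n ] (a n ≡ g)) × ((m n : ℕ) → a m ≡ a n → m ≡ n) ×
  (∃[ N ] ∃[ π ] Σ ℤ λ s → ((1 ≤ π) × ((n : ℕ) → N ≤ n → + a (n + π) ≡ (+ a n) +ℤ s)))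
periodicPermutation⇒integerSaltus (surjective , injective , N , π , 1≤π , periodic) =
  surjective , (λ _ _ → injective) , N , π , + π , 1≤π , λ n N≤n → cong +_ (periodic n N≤n)

mainTheorem8 : (r0 : Tree) (v : Vertex r0) →
    ((g : ℕ) → ∃[ n ] (grundy (ray r0 v n) ≡ g))
    × ((m n : ℕ) → grundy (ray r0 v m) ≡ grundy (ray r0 v n) → m ≡ n)
    × (∃[ N ] ∃[ π ] Σ ℤ λ s → ((1 ≤ π) × ((n : ℕ) → N ≤ n →
        + grundy (ray r0 v (n + π)) ≡ (+ grundy (ray r0 v n)) +ℤ s)))
mainTheorem8 r0 v = periodicPermutation⇒integerSaltus (ray-periodicPermutation r0 v)
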